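{- Let $S$ and $T$ be $k$-orthogonal tree decompositions of a graph $G$, where $S$ has magnitude $s$. Then $|E(G)|\le (k-1)s$. In particular, if $s\le c|V(G)|$ then $|E(G)|\le c(k-1)|V(G)|$.
   Context: A tree decomposition of $G$ is a tree with bags $S_x\subseteq V(G)$ such that every edge has both ends in some bag and for every vertex $v$ the nodes whose bags contain $v$ induce a non-empty connected subtree. Two tree decompositions $S$ and $T$ of $G$ are $k$-orthogonal if $|S_x\cap T_y|\le k$ for all nodes $x$ of $S$ and $y$ of $T$. The magnitude of $S$ is $\sum_x|S_x|$. -}

module Defs where

open import Data.Nat using (ℕ; zero; suc; _+_; _*_; _≤_; _<ᵇ_)
open import Data.Bool using (Bool; true; false; _∧_; if_then_else_)
open import Data.Fin using (Fin; toℕ)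
open import Data.List using (List; []; _∷_; map; allFin; length)
open import Data.Nat.ListAction using (sum)
open import Data.List.Relation.Unary.All using (All)
open import Data.List.Relation.Unary.Unique.Propositional using (Unique)
open import Data.Product using (Σ; ∃; _×_; _,_)
open import Relation.Binary.PropositionalEquality using (_≡_)
open import Relation.Nullary using (¬_)

count : ∀ {n} → (Fin n → Bool) → ℕ
count {n} p = sum (map (λ v → if p v then 1 else 0) (allFin n))

record Graph (n : ℕ) : Set where
  field
    adj    : Fin n → Fin n → Bool
    sym    : ∀ i j → adj i j ≡ adj j i
    irrefl : ∀ i → adj i i ≡ false
open Graph public

edgeCount : ∀ {n} → Graph n → ℕ
edgeCount {n} G =
  sum (map (λ i → count (λ j → adj G i j ∧ (toℕ i <ᵇ toℕ j))) (allFin n))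

data Walk {n : ℕ} (G : Graph n) : Fin n → Fin n → List (Fin n) → Set where
  here : ∀ {x} → Walk G x x (x ∷ [])
  step : ∀ {x y z vs} → adj G x y ≡ true → Walk G y z vs → Walk G x z (x ∷ vs)

InducesConnected : ∀ {n} → Graph n → (Fin n → Bool) → Set
InducesConnected G P =
  ∀ x y → P x ≡ true → P y ≡ true →
    ∃ λ vs → Walk G x y vs × All (λ v → P v ≡ true) vs

Connected : ∀ {n} → Graph n → Set
Connected G = ∀ x y → ∃ λ vs → Walk G x y vs

-- A cycle: distinct vertices v0 … v(l-1), l ≥ 3, consecutive ones adjacent
-- and v(l-1) adjacent to v0.
HasCycle : ∀ {n} → Graph n → Set
HasCycle {n} G =
  Σ (Fin n) λ x → Σ (Fin n) λ y → ∃ λ vs →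
    Walk G x y vs × Unique vs × 3 ≤ length vs × adj G y x ≡ true

record IsTree {m : ℕ} (T : Graph m) : Set where
  field
    nonempty  : 1 ≤ m
    connected : Connected T
    acyclic   : ¬ HasCycle T

record TreeDecomposition {n : ℕ} (G : Graph n) : Set where
  field
    nodes    : ℕ
    tree     : Graph nodes
    isTree   : IsTree tree
    bag      : Fin nodes → Fin n → Bool
    edgeCov  : ∀ u v → adj G u v ≡ true →
                 ∃ λ x → bag x u ≡ true × bag x v ≡ true
    vertexNonempty : ∀ v → ∃ λ x → bag x v ≡ true
    vertexConnected : ∀ v → InducesConnected tree (λ x → bag x v)
open TreeDecomposition public

magnitude : ∀ {n} {G : Graph n} → TreeDecomposition G → ℕ
magnitude {n} S = sum (map (λ x → count (bag S x)) (allFin (nodes S)))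

Orthogonal : ∀ {n} {G : Graph n} → ℕ → TreeDecomposition G → TreeDecomposition G → Set
Orthogonal k S T =
  ∀ (x : Fin (nodes S)) (y : Fin (nodes T)) →
    count (λ v → bag S x v ∧ bag T y v) ≤ k

module Submission where

-- Every edge of G lies inside some bag S_x, so |E(G)| ≤ Σ_x e(S_x), where
-- e(A) counts the edges of G with both ends in A.  It therefore suffices to
-- show e(A) ≤ (k-1)|A| for every A meeting each bag of T in at most k
-- vertices.  The key fact is that for any tree decomposition T and any
-- non-empty A there is a vertex v ∈ A and a bag T_y containing v together
-- with all of its neighbours in A.  (We find it by walking through the
-- tree T, always heading into the branch that holds the bags of the current
-- vertex; the visited nodes are left behind for good, so the walk ends.)
-- For such v, deg_A(v) + 1 ≤ |A ∩ T_y| ≤ k, so deleting v loses at most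
-- k-1 edges, and induction on |A| gives e(A) ≤ (k-1)|A|.

open import Defs hiding (sym)
open import Data.Nat
  using (ℕ; zero; suc; _+_; _*_; _∸_; _≤_; _<_; _<ᵇ_; z≤n; s≤s)
open import Data.Nat.Properties
  using ( +-*-semiring; +-assoc; +-mono-≤; +-monoʳ-≤; +-comm; +-suc; *-suc
        ; ∸-monoˡ-≤; m≤m+n; m≤n+m; ≤-refl; ≤-trans; ≤-reflexive; suc-injective
        ; module ≤-Reasoning)
open import Data.Nat.Induction using (<-wellFounded)
open import Data.Nat.ListAction using (sum)
open import Data.Integer using (+_)
import Data.Integer as ℤ
import Data.Integer.Properties as ℤ
open import Data.Rational using (ℚ; _/_; mkℚ; *≤*)
  renaming (_≤_ to _≤ℚ_; _*_ to _*ℚ_)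
import Data.Rational.Properties as ℚ
import Data.Nat.Coprimality as Coprime
open import Data.Bool using (Bool; true; false; _∧_; _∨_; not; if_then_else_)
import Data.Bool as Bool
open import Data.Bool.Properties using (¬-not; ∧-zeroʳ)
open import Data.Fin using (Fin; zero; suc; toℕ)
open import Data.Fin.Properties using (_≟_; any?)
import Data.Fin.Properties as Fin
open import Data.List using (List; []; _∷_; map; allFin; tabulate; length)
open import Data.List.Properties using (map-tabulate)
open import Data.List.Relation.Unary.All using (All; []; _∷_; universal)
import Data.List.Relation.Unary.All as All
open import Data.List.Relation.Unary.All.Properties using (¬Any⇒All¬)
open import Data.List.Relation.Unary.Any using (here; there)
open import Data.List.Relation.Unary.AllPairs using ([]; _∷_)
open import Data.List.Relation.Unary.Unique.Propositional using (Unique)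
open import Data.List.Membership.Propositional using (_∈_; _∉_)
open import Data.Maybe using (Maybe; just; nothing)
open import Data.Product using (Σ; ∃; _×_; _,_; proj₁)
open import Data.Unit using (⊤; tt)
open import Data.Empty using (⊥-elim)
open import Function using (_∘_; id)
open import Induction.WellFounded using (Acc; acc)
open import Relation.Nullary using (¬_; yes; no; does; contradiction)
open import Relation.Nullary.Decidable using (dec-true; dec-false; _×-dec_)
open import Relation.Binary.PropositionalEquality
  using (_≡_; _≢_; refl; sym; trans; cong; cong₂; subst; subst₂; module ≡-Reasoning)
open import Algebra.Properties.Semiring.Sum +-*-semiring
  using (sum-syntax; ∑-comm; ∑-distrib-+; *-distribˡ-sum; sum-cong-≗; sum-replicate-zero)
  renaming (sum to ∑)

sum-allFin : ∀ {n} (f : Fin n → ℕ) → sum (map f (allFin n)) ≡ ∑[ i < n ] f i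
sum-allFin f = trans (cong sum (map-tabulate id f)) (sum-tabulate f)
  where
  sum-tabulate : ∀ {n} (g : Fin n → ℕ) → sum (tabulate g) ≡ ∑[ i < n ] g i
  sum-tabulate {zero}  g = refl
  sum-tabulate {suc n} g = cong (_+_ (g zero)) (sum-tabulate (g ∘ suc))

∑-mono : ∀ {n} {f g : Fin n → ℕ} → (∀ i → f i ≤ g i) → ∑[ i < n ] f i ≤ ∑[ i < n ] g i
∑-mono {zero}  _   = z≤n
∑-mono {suc n} f≤g = +-mono-≤ (f≤g zero) (∑-mono (f≤g ∘ suc))

term≤∑ : ∀ {n} (f : Fin n → ℕ) i → f i ≤ ∑[ j < n ] f j
term≤∑ f zero    = m≤m+n (f zero) _
term≤∑ f (suc i) = ≤-trans (term≤∑ (f ∘ suc) i) (m≤n+m _ (f zero))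

at : ∀ {n} → Fin n → Fin n → ℕ → ℕ
at v i a = if does (i ≟ v) then a else 0

∑-at : ∀ {n} (v : Fin n) a → ∑[ i < n ] at v i a ≡ a
∑-at {suc n} zero a = begin
  a + ∑[ i < n ] 0  ≡⟨ cong (_+_ a) (sum-replicate-zero n) ⟩
  a + 0             ≡⟨ +-comm a 0 ⟩
  a                 ∎
  where open ≡-Reasoning
∑-at {suc n} (suc v) a = ∑-at v a

∑-at-row : ∀ {n} (v i : Fin n) (f : Fin n → ℕ) → ∑[ j < n ] at v i (f j) ≡ at v i (∑[ j < n ] f j)
∑-at-row {n} v i f with i ≟ v
... | yes _ = refl
... | no  _ = sum-replicate-zero n

ind : Bool → ℕ
ind b = if b then 1 else 0

size : ∀ {n} → (Fin n → Bool) → ℕ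
size {n} A = ∑[ x < n ] ind (A x)

count≡size : ∀ {n} (A : Fin n → Bool) → count A ≡ size A
count≡size A = sum-allFin (ind ∘ A)

size-mono : ∀ {n} {A B : Fin n → Bool} → (∀ x → A x ≡ true → B x ≡ true) → size A ≤ size B
size-mono {A = A} {B} A⊆B = ∑-mono pointwise
  where
  pointwise : ∀ x → ind (A x) ≤ ind (B x)
  pointwise x with A x in Ax
  ... | false = z≤n
  ... | true rewrite A⊆B x Ax = ≤-refl

size-remove : ∀ {n} {A B : Fin n → Bool} {v} → A v ≡ true → B v ≡ false →
              (∀ x → x ≢ v → A x ≡ B x) → size A ≡ suc (size B)
size-remove {suc n} {A} {B} {zero} Av Bv agree rewrite Av | Bv =
  cong suc (sum-cong-≗ (λ x → cong ind (agree (suc x) λ ())))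
size-remove {suc n} {A} {B} {suc v} Av Bv agree = begin
  ind (A zero) + size (A ∘ suc)      ≡⟨ cong₂ _+_ (cong ind (agree zero λ ())) tail ⟩
  ind (B zero) + suc (size (B ∘ suc)) ≡⟨ +-suc (ind (B zero)) _ ⟩
  suc (size B)                        ∎
  where
  open ≡-Reasoning
  tail : size (A ∘ suc) ≡ suc (size (B ∘ suc))
  tail = size-remove Av Bv (λ x x≢v → agree (suc x) (x≢v ∘ Fin.suc-injective))

_─_ : ∀ {n} → (Fin n → Bool) → Fin n → (Fin n → Bool)
(A ─ v) x = if does (x ≟ v) then false else A x

size-─ : ∀ {n} {A : Fin n → Bool} {v} → A v ≡ true → size A ≡ suc (size (A ─ v))
size-─ {A = A} {v} Av = size-remove Av v∉A─v agree
  where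
  v∉A─v : (A ─ v) v ≡ false
  v∉A─v rewrite dec-true (v ≟ v) refl = refl
  agree : ∀ x → x ≢ v → A x ≡ (A ─ v) x
  agree x x≢v rewrite dec-false (x ≟ v) x≢v = refl

module _ {n : ℕ} (G : Graph n) where

  Edge : Fin n → Fin n → Bool
  Edge i j = adj G i j ∧ (toℕ i <ᵇ toℕ j)

  edgesIn : (Fin n → Bool) → ℕ
  edgesIn A = ∑[ i < n ] ∑[ j < n ] ind (A i ∧ A j ∧ Edge i j)

  degIn : (Fin n → Bool) → Fin n → ℕ
  degIn A v = size (λ u → A u ∧ adj G v u)

  edgeCount≡edgesIn : edgeCount G ≡ edgesIn (λ _ → true)
  edgeCount≡edgesIn = trans (sum-allFin (λ i → count (Edge i)))
                            (sum-cong-≗ (λ i → sum-allFin (ind ∘ Edge i)))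

  edgesIn-empty : ∀ {A} → (∀ x → A x ≡ false) → edgesIn A ≡ 0
  edgesIn-empty {A} empty =
    trans (sum-cong-≗ λ i → trans (sum-cong-≗ λ j → cong (λ b → ind (b ∧ A j ∧ Edge i j)) (empty i))
                                  (sum-replicate-zero n))
          (sum-replicate-zero n)

  edgeCount≤∑bags : (S : TreeDecomposition G) →
    edgeCount G ≤ ∑[ x < nodes S ] edgesIn (bag S x)
  edgeCount≤∑bags S = begin
    edgeCount G                                                    ≡⟨ edgeCount≡edgesIn ⟩
    ∑[ i < n ] ∑[ j < n ] ind (Edge i j)                             ≤⟨ ∑-mono (λ i → ∑-mono (covered i)) ⟩
    ∑[ i < n ] ∑[ j < n ] ∑[ x < nodes S ] inBag x i j               ≡⟨ sum-cong-≗ (λ i → ∑-comm (λ j x → inBag x i j)) ⟩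
    ∑[ i < n ] ∑[ x < nodes S ] ∑[ j < n ] inBag x i j               ≡⟨ ∑-comm (λ i x → ∑[ j < n ] inBag x i j) ⟩
    ∑[ x < nodes S ] edgesIn (bag S x)                               ∎
    where
    open ≤-Reasoning
    inBag : Fin (nodes S) → Fin n → Fin n → ℕ
    inBag x i j = ind (bag S x i ∧ bag S x j ∧ Edge i j)
    covered : ∀ i j → ind (Edge i j) ≤ ∑[ x < nodes S ] inBag x i j
    covered i j with adj G i j in ij
    ... | false = z≤n
    ... | true with edgeCov S i j ij
    ...   | x , xi , xj =
      ≤-trans (≤-reflexive (cong₂ (λ a b → ind (a ∧ b ∧ i<j)) (sym xi) (sym xj)))
              (term≤∑ (λ x → ind (bag S x i ∧ bag S x j ∧ i<j)) x)
      where
      i<j : Bool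
      i<j = toℕ i <ᵇ toℕ j

  edgesIn-─ : ∀ {A} v → A v ≡ true → edgesIn A ≤ edgesIn (A ─ v) + degIn A v
  edgesIn-─ {A} v Av = begin
    edgesIn A
      ≤⟨ ∑-mono (λ i → ∑-mono (split i)) ⟩
    ∑∑ (λ i j → kept i j + row i j + column i j)
      ≡⟨ ∑∑-distrib-+ (λ i j → kept i j + row i j) column ⟩
    ∑∑ (λ i j → kept i j + row i j) + ∑∑ column
      ≡⟨ cong₂ _+_ ∑∑row ∑∑column ⟩
    edgesIn (A ─ v) + ∑[ j < n ] out j + ∑[ i < n ] into i
      ≡⟨ +-assoc (edgesIn (A ─ v)) _ _ ⟩
    edgesIn (A ─ v) + (∑[ j < n ] out j + ∑[ i < n ] into i)
      ≡⟨ cong (_+_ (edgesIn (A ─ v))) (∑-distrib-+ out into) ⟨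
    edgesIn (A ─ v) + ∑[ j < n ] (out j + into j)
      ≤⟨ +-monoʳ-≤ (edgesIn (A ─ v)) (∑-mono out+into≤) ⟩
    edgesIn (A ─ v) + degIn A v
      ∎
    where
    open ≤-Reasoning
    -- edges from v to a later / an earlier vertex of A
    out into : Fin n → ℕ
    out  j = ind (A j ∧ Edge v j)
    into i = ind (A i ∧ Edge i v)
    -- edges of A ─ v, and the edges at v counted from their first and
    -- from their second end
    kept row column : Fin n → Fin n → ℕ
    kept   i j = ind ((A ─ v) i ∧ (A ─ v) j ∧ Edge i j)
    row    i j = at v i (out j)
    column i j = at v j (into i)
    ∑∑ : (Fin n → Fin n → ℕ) → ℕ
    ∑∑ f = ∑[ i < n ] ∑[ j < n ] f i j
    ∑∑-distrib-+ : ∀ f g → ∑∑ (λ i j → f i j + g i j) ≡ ∑∑ f + ∑∑ g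
    ∑∑-distrib-+ f g = trans (sum-cong-≗ (λ i → ∑-distrib-+ (f i) (g i)))
                             (∑-distrib-+ (λ i → ∑[ j < n ] f i j) (λ i → ∑[ j < n ] g i j))
    ∑∑row : ∑∑ (λ i j → kept i j + row i j) ≡ edgesIn (A ─ v) + ∑[ j < n ] out j
    ∑∑row = trans (∑∑-distrib-+ kept row)
                  (cong (_+_ (∑∑ kept)) (trans (sum-cong-≗ (λ i → ∑-at-row v i out)) (∑-at v _)))
    ∑∑column : ∑∑ column ≡ ∑[ i < n ] into i
    ∑∑column = sum-cong-≗ (λ i → ∑-at v (into i))
    split : ∀ i j → ind (A i ∧ A j ∧ Edge i j) ≤ kept i j + row i j + column i j
    split i j with i ≟ v | j ≟ v
    ... | yes refl | _     rewrite Av = m≤m+n (out j) _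
    ... | no _     | yes refl rewrite Av = m≤n+m (into i) _
    ... | no _     | no _  = ≤-trans (m≤m+n _ 0) (m≤m+n _ 0)
    out+into≤ : ∀ j → out j + into j ≤ ind (A j ∧ adj G v j)
    out+into≤ j rewrite Graph.sym G j v with A j | adj G v j
    ... | false | _     = z≤n
    ... | true  | false = z≤n
    ... | true  | true  = <ᵇ-asym (toℕ v) (toℕ j)
      where
      <ᵇ-asym : ∀ a b → ind (a <ᵇ b) + ind (b <ᵇ a) ≤ 1
      <ᵇ-asym zero    zero    = z≤n
      <ᵇ-asym zero    (suc b) = s≤s z≤n
      <ᵇ-asym (suc a) zero    = s≤s z≤n
      <ᵇ-asym (suc a) (suc b) = <ᵇ-asym a b

  edgesIn-degenerate : (d : ℕ) (P : (Fin n → Bool) → Set) →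
    (∀ {A} v → P A → P (A ─ v)) →
    (∀ {A} a → P A → A a ≡ true → ∃ λ v → A v ≡ true × degIn A v ≤ d) →
    ∀ A → P A → edgesIn A ≤ d * size A
  edgesIn-degenerate d P P-─ low A = go (size A) A refl
    where
    go : ∀ s A → size A ≡ s → P A → edgesIn A ≤ d * s
    go s A _ PA with any? (λ x → A x Bool.≟ true)
    ... | no empty = ≤-trans (≤-reflexive (edgesIn-empty (λ x → ¬-not (λ Ax → empty (x , Ax))))) z≤n
    go zero A |A| PA | yes (a , Aa) with () ← trans (sym (size-─ {A = A} Aa)) |A|
    go (suc s) A |A| PA | yes (a , Aa) with low a PA Aa
    ... | v , Av , deg≤d = begin
      edgesIn A                        ≤⟨ edgesIn-─ v Av ⟩
      edgesIn (A ─ v) + degIn A v      ≤⟨ +-mono-≤ (go s (A ─ v) |A─v| (P-─ v PA)) deg≤d ⟩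
      d * s + d                        ≡⟨ +-comm (d * s) d ⟩
      d + d * s                        ≡⟨ sym (*-suc d s) ⟩
      d * suc s                        ∎
      where
      open ≤-Reasoning
      |A─v| : size (A ─ v) ≡ s
      |A─v| = suc-injective (trans (sym (size-─ {A = A} Av)) |A|)

module Trees {m : ℕ} (T : Graph m) where

  open import Data.List.Membership.DecPropositional (_≟_ {m}) public using (_∈?_)

  WalkIn : (Fin m → Set) → Fin m → Fin m → Set
  WalkIn P x y = ∃ λ vs → Walk T x y vs × All P vs

  PathIn : (Fin m → Set) → Fin m → Fin m → Set
  PathIn P x y = ∃ λ vs → Walk T x y vs × Unique vs × All P vs

  module _ {P : Fin m → Set} where

    walkIn-start : ∀ {x y} → WalkIn P x y → P x
    walkIn-start (_ , here     , Px ∷ _) = Px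
    walkIn-start (_ , step _ _ , Px ∷ _) = Px

    walkIn-end : ∀ {x y} → WalkIn P x y → P y
    walkIn-end (_ , here     , Py ∷ _)  = Py
    walkIn-end (_ , step _ w , _ ∷ Pvs) = walkIn-end (_ , w , Pvs)

    walkIn-++ : ∀ {x y z} → WalkIn P x y → WalkIn P y z → WalkIn P x z
    walkIn-++ (_ , here     , _)        w₂ = w₂
    walkIn-++ (_ , step e w , Px ∷ Pvs) w₂ with walkIn-++ (_ , w , Pvs) w₂
    ... | _ , w′ , Pws = _ , step e w′ , Px ∷ Pws

    walkIn-upTo : ∀ {x y z vs} → Walk T x y vs → All P vs → z ∈ vs → WalkIn P x z
    walkIn-upTo here       (Px ∷ _)   (here refl) = _ , here , Px ∷ []
    walkIn-upTo (step _ _) (Px ∷ _)   (here refl) = _ , here , Px ∷ []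
    walkIn-upTo (step e w) (Px ∷ Pvs) (there z∈) with walkIn-upTo w Pvs z∈
    ... | _ , w′ , Pws = _ , step e w′ , Px ∷ Pws

    pathIn-from : ∀ {x y z vs} → Walk T y z vs → Unique vs → All P vs → x ∈ vs → PathIn P x z
    pathIn-from here       u          Pvs        (here refl) = _ , here , u , Pvs
    pathIn-from (step e w) u          Pvs        (here refl) = _ , step e w , u , Pvs
    pathIn-from (step e w) (_ ∷ u)    (_ ∷ Pvs)  (there x∈)  = pathIn-from w u Pvs x∈

    pathIn : ∀ {x y} → WalkIn P x y → PathIn P x y
    pathIn (_ , here , Pvs) = _ , here , [] ∷ [] , Pvs
    pathIn (_ , step {x = x} e w , Px ∷ Pvs) with pathIn (_ , w , Pvs)
    ... | ws , w′ , u , Pws with x ∈? ws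
    ...   | yes x∈ = pathIn-from w′ u Pws x∈
    ...   | no  x∉ = x ∷ ws , step e w′ , ¬Any⇒All¬ ws x∉ ∷ u , Px ∷ Pws

  adj⇒≢ : ∀ {x y} → adj T x y ≡ true → x ≢ y
  adj⇒≢ {x} xy refl with trans (sym (irrefl T x)) xy
  ... | ()

  walk-length : ∀ {p q ws} → Walk T p q ws → p ≢ q → 2 ≤ length ws
  walk-length here                p≢q = contradiction refl p≢q
  walk-length (step _ here)       _   = s≤s (s≤s z≤n)
  walk-length (step _ (step _ _)) _   = s≤s (s≤s z≤n)

  -- In a tree, two distinct neighbours of x are joined only through x:
  -- a path between them avoiding x would close a cycle with x.
  separated : IsTree T → ∀ {x p q} → adj T x p ≡ true → adj T x q ≡ true → p ≢ q →
              ¬ WalkIn (x ≢_) p q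
  separated tree {x} {q = q} xp xq p≢q walk with pathIn walk
  ... | ws , w , u , x∉ws =
    IsTree.acyclic tree
      (x , q , x ∷ ws , step xp w , x∉ws ∷ u , s≤s (walk-length w p≢q) , trans (Graph.sym T q x) xq)

  -- The branch at y facing away from the optional node `par`: the nodes
  -- reachable from y without passing through par.
  Away : Maybe (Fin m) → Fin m → Set
  Away nothing  _ = ⊤
  Away (just p) z = p ≢ z

  Branch : Maybe (Fin m) → Fin m → Fin m → Set
  Branch par y = WalkIn (Away par) y

  Attached : Maybe (Fin m) → Fin m → Set
  Attached nothing  _ = ⊤
  Attached (just p) y = adj T p y ≡ true

  branch-shrink : IsTree T → ∀ {par y y′ w} → Attached par y → adj T y y′ ≡ true →
                  Away par y′ → Branch (just y) y′ w → Branch par y w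
  branch-shrink tree {nothing} _ yy′ _ (us , w , _) = _ , step yy′ w , universal (λ _ → tt) _
  branch-shrink tree {just p} {y} py yy′ p≢y′ (us , w , y∉us) with p ∈? us
  ... | yes p∈ = ⊥-elim (separated tree yy′ (trans (Graph.sym T y p) py) (p≢y′ ∘ sym)
                                    (walkIn-upTo w y∉us p∈))
  ... | no  p∉ = _ , step yy′ w , adj⇒≢ py ∷ ¬Any⇒All¬ us p∉

  branch-step : ∀ {par y w} → Branch par y w → y ≢ w →
                ∃ λ y′ → adj T y y′ ≡ true × Away par y′ × Branch (just y) y′ w
  branch-step b y≢w with pathIn b
  ... | _ , here , _ , _ = contradiction refl y≢w
  ... | _ , step {y = y′} yy′ w , y∉ws ∷ _ , _ ∷ away =
    y′ , yy′ , walkIn-start (_ , w , away) , _ , w , y∉ws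

HoldsNeighbourhood : ∀ {n} {G : Graph n} (D : TreeDecomposition G) (A : Fin n → Bool) →
                     Fin n → Fin (nodes D) → Set
HoldsNeighbourhood {G = G} D A v y =
  bag D y v ≡ true × (∀ u → A u ≡ true → adj G v u ≡ true → bag D y u ≡ true)

module Descent {n : ℕ} {G : Graph n} (D : TreeDecomposition G) (A : Fin n → Bool) where

  open Trees (tree D)

  -- The state of the walk through the tree of D: we stand at `node`, having
  -- come from `parent`; every bag of the current vertex of A lies ahead of
  -- us, and every node visited so far lies behind us.
  record State : Set where
    field
      parent         : Maybe (Fin (nodes D))
      node           : Fin (nodes D)
      vertex         : Fin n
      visited        : List (Fin (nodes D))
      vertex∈A       : A vertex ≡ true
      attached       : Attached parent node
      away           : Away parent node
      bags-ahead     : ∀ z → bag D z vertex ≡ true → Branch parent node z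
      visited-behind : All (λ z → ¬ Branch parent node z) visited
  open State

  -- The number of nodes not yet visited; it decreases with every move.
  unvisited : List (Fin (nodes D)) → ℕ
  unvisited vs = size (λ z → not (does (z ∈? vs)))

  unvisited-∷ : ∀ {y vs} → y ∉ vs → unvisited vs ≡ suc (unvisited (y ∷ vs))
  unvisited-∷ {y} {vs} y∉vs = size-remove fresh visitedNow agree
    where
    fresh : not (does (y ∈? vs)) ≡ true
    fresh rewrite dec-false (y ∈? vs) y∉vs = refl
    visitedNow : not (does (y ∈? (y ∷ vs))) ≡ false
    visitedNow rewrite dec-true (y ∈? (y ∷ vs)) (here refl) = refl
    agree : ∀ z → z ≢ y → not (does (z ∈? vs)) ≡ not (does (z ∈? (y ∷ vs)))
    agree z z≢y rewrite dec-false (z ≟ y) z≢y = refl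

  lacks⇒≢ : ∀ {t x z} → bag D x t ≡ false → bag D z t ≡ true → x ≢ z
  lacks⇒≢ x∌t z∋t refl with trans (sym x∌t) z∋t
  ... | ()

  advance : (s : State) (t : Fin n) → A t ≡ true → bag D (node s) t ≡ false →
            ∀ z → bag D z t ≡ true → Branch (parent s) (node s) z →
            Σ State λ s′ → unvisited (visited s′) < unvisited (visited s)
  advance s t At y∌t z z∋t z-ahead with branch-step z-ahead (lacks⇒≢ y∌t z∋t)
  ... | y′ , yy′ , y′-away , z-ahead′ = s′ , ≤-reflexive (sym (unvisited-∷ y∉visited))
    where
    y : Fin (nodes D)
    y = node s
    -- the bags of t are connected and avoid y, so they all lie beyond z
    bags-ahead′ : ∀ w → bag D w t ≡ true → Branch (just y) y′ w
    bags-ahead′ w w∋t with vertexConnected D t z w z∋t w∋t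
    ... | _ , walk , inBags =
      walkIn-++ z-ahead′ (_ , walk , All.map (lacks⇒≢ y∌t) inBags)
    y∉visited : y ∉ visited s
    y∉visited y∈ = All.lookup (visited-behind s) y∈ (_ , here , away s ∷ [])
    s′ : State
    s′ = record
      { parent         = just y
      ; node           = y′
      ; vertex         = t
      ; visited        = y ∷ visited s
      ; vertex∈A       = At
      ; attached       = yy′
      ; away           = adj⇒≢ yy′
      ; bags-ahead     = bags-ahead′
      ; visited-behind =
          (λ b → walkIn-end b refl) ∷
          All.map (λ behind → behind ∘ branch-shrink (isTree D) (attached s) yy′ y′-away)
                  (visited-behind s)
      }

  -- If the current node lacks the current vertex v, move towards a bag of v;
  -- if it lacks a neighbour u ∈ A of v, move towards a bag holding the edge
  -- uv and continue with u; otherwise the current node is the bag we seek.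
  descend : (s : State) → Acc _<_ (unvisited (visited s)) →
            ∃ λ v → A v ≡ true × ∃ λ y → HoldsNeighbourhood D A v y
  descend s (acc more) with bag D (node s) (vertex s) in y∋v
  ... | false with vertexNonempty D (vertex s)
  ...   | z , z∋v with advance s (vertex s) (vertex∈A s) y∋v z z∋v (bags-ahead s z z∋v)
  ...     | s′ , fewer = descend s′ (more fewer)
  descend s (acc more) | true with any? (λ u →
    (A u Bool.≟ true) ×-dec (adj G (vertex s) u Bool.≟ true) ×-dec (bag D (node s) u Bool.≟ false))
  ... | yes (u , Au , vu , y∌u) with edgeCov D (vertex s) u vu
  ...   | z , z∋v , z∋u with advance s u Au y∌u z z∋u (bags-ahead s z z∋v)
  ...     | s′ , fewer = descend s′ (more fewer)
  descend s (acc more) | true | no none = vertex s , vertex∈A s , node s , y∋v , holds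
    where
    holds : ∀ u → A u ≡ true → adj G (vertex s) u ≡ true → bag D (node s) u ≡ true
    holds u Au vu = ¬-not λ y∌u → none (u , Au , vu , y∌u)

  neighbourhood-in-bag : ∀ a → A a ≡ true →
    ∃ λ v → A v ≡ true × ∃ λ y → HoldsNeighbourhood D A v y
  neighbourhood-in-bag a Aa = descend start (<-wellFounded _)
    where
    y₀ : Fin (nodes D)
    y₀ = proj₁ (vertexNonempty D a)
    everywhere : ∀ z → Branch nothing y₀ z
    everywhere z with IsTree.connected (isTree D) y₀ z
    ... | vs , walk = vs , walk , universal (λ _ → tt) vs
    start : State
    start = record
      { parent = nothing ; node = y₀ ; vertex = a ; visited = []
      ; vertex∈A = Aa ; attached = tt ; away = tt
      ; bags-ahead = λ z _ → everywhere z ; visited-behind = [] }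

open Descent using (neighbourhood-in-bag)

module _ {n : ℕ} {G : Graph n} (T : TreeDecomposition G) (k : ℕ) where

  Thin : (Fin n → Bool) → Set
  Thin A = ∀ y → size (λ x → A x ∧ bag T y x) ≤ k

  thin-─ : ∀ {A} v → Thin A → Thin (A ─ v)
  thin-─ {A} v thin y = ≤-trans (size-mono ⊆) (thin y)
    where
    ⊆ : ∀ x → ((A ─ v) x ∧ bag T y x) ≡ true → (A x ∧ bag T y x) ≡ true
    ⊆ x with x ≟ v
    ... | yes _ = λ ()
    ... | no  _ = id

  -- The closed neighbourhood of v in A has deg_A(v) + 1 elements, and it
  -- lies in A ∩ T_y when T_y holds v and its neighbourhood.
  degIn<size : ∀ {A v y} → A v ≡ true → HoldsNeighbourhood T A v y →
               suc (degIn G A v) ≤ size (λ x → A x ∧ bag T y x)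
  degIn<size {A} {v} {y} Av (y∋v , y∋N) =
    subst (_≤ _) (size-remove v∈N[v] v∉N agree) (size-mono N[v]⊆)
    where
    N[v] : Fin n → Bool
    N[v] x = does (x ≟ v) ∨ (A x ∧ adj G v x)
    v∈N[v] : N[v] v ≡ true
    v∈N[v] rewrite dec-true (v ≟ v) refl = refl
    v∉N : (A v ∧ adj G v v) ≡ false
    v∉N rewrite irrefl G v = ∧-zeroʳ (A v)
    agree : ∀ x → x ≢ v → N[v] x ≡ (A x ∧ adj G v x)
    agree x x≢v rewrite dec-false (x ≟ v) x≢v = refl
    N[v]⊆ : ∀ x → N[v] x ≡ true → (A x ∧ bag T y x) ≡ true
    N[v]⊆ x with x ≟ v
    ... | yes refl = λ _ → cong₂ _∧_ Av y∋v
    ... | no  _ with A x in Ax | adj G v x in vx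
    ...   | true  | true  = λ _ → y∋N x Ax vx
    ...   | true  | false = λ ()
    ...   | false | _     = λ ()

  edgesIn-thin : ∀ A → Thin A → edgesIn G A ≤ (k ∸ 1) * size A
  edgesIn-thin = edgesIn-degenerate G (k ∸ 1) Thin thin-─ low
    where
    low : ∀ {A} a → Thin A → A a ≡ true → ∃ λ v → A v ≡ true × degIn G A v ≤ k ∸ 1
    low {A} a thin Aa with neighbourhood-in-bag T A a Aa
    ... | v , Av , y , holds =
      v , Av , ∸-monoˡ-≤ 1 (≤-trans (degIn<size Av holds) (thin y))

⟦_⟧ : ℕ → ℚ
⟦ a ⟧ = (+ a) / 1

⟦⟧≡mkℚ : ∀ a → ⟦ a ⟧ ≡ mkℚ (+ a) 0 (Coprime.sym (Coprime.1-coprimeTo a))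
⟦⟧≡mkℚ a = ℚ.↥p/↧p≡p (mkℚ (+ a) 0 (Coprime.sym (Coprime.1-coprimeTo a)))

⟦⟧-mono : ∀ {a b} → a ≤ b → ⟦ a ⟧ ≤ℚ ⟦ b ⟧
⟦⟧-mono {a} {b} a≤b rewrite ⟦⟧≡mkℚ a | ⟦⟧≡mkℚ b =
  *≤* (subst₂ ℤ._≤_ (sym (ℤ.*-identityʳ (+ a))) (sym (ℤ.*-identityʳ (+ b))) (ℤ.+≤+ a≤b))

⟦⟧-* : ∀ a b → ⟦ a * b ⟧ ≡ ⟦ a ⟧ *ℚ ⟦ b ⟧
⟦⟧-* a b rewrite ⟦⟧≡mkℚ a | ⟦⟧≡mkℚ b = cong (_/ 1) (ℤ.pos-* a b)

rescale : ∀ e d s N (c : ℚ) → e ≤ d * s → ⟦ s ⟧ ≤ℚ c *ℚ ⟦ N ⟧ → ⟦ e ⟧ ≤ℚ (c *ℚ ⟦ d ⟧) *ℚ ⟦ N ⟧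
rescale e d s N c e≤ds s≤cN = begin
  ⟦ e ⟧                  ≤⟨ ⟦⟧-mono e≤ds ⟩
  ⟦ d * s ⟧              ≡⟨ ⟦⟧-* d s ⟩
  ⟦ d ⟧ *ℚ ⟦ s ⟧         ≤⟨ ℚ.*-monoˡ-≤-nonNeg ⟦ d ⟧ {{ℚ.normalize-nonNeg d 1}} s≤cN ⟩
  ⟦ d ⟧ *ℚ (c *ℚ ⟦ N ⟧)  ≡⟨ sym (ℚ.*-assoc ⟦ d ⟧ c ⟦ N ⟧) ⟩
  ⟦ d ⟧ *ℚ c *ℚ ⟦ N ⟧    ≡⟨ cong (_*ℚ ⟦ N ⟧) (ℚ.*-comm ⟦ d ⟧ c) ⟩
  c *ℚ ⟦ d ⟧ *ℚ ⟦ N ⟧    ∎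
  where open ℚ.≤-Reasoning

lemma8 : ∀ {n : ℕ} (G : Graph n) (S T : TreeDecomposition G) (k : ℕ) →
    Orthogonal k S T →
    (edgeCount G ≤ (k ∸ 1) * magnitude S)
    × (∀ (c : ℚ) → (+ magnitude S) / 1 ≤ℚ c *ℚ ((+ n) / 1) →
         (+ edgeCount G) / 1 ≤ℚ (c *ℚ ((+ (k ∸ 1)) / 1)) *ℚ ((+ n) / 1))
lemma8 {n} G S T k orthogonal =
  edgeBound , λ c → rescale (edgeCount G) (k ∸ 1) (magnitude S) n c edgeBound
  where
  bags-thin : ∀ x → Thin T k (bag S x)
  bags-thin x y = subst (_≤ k) (count≡size (λ v → bag S x v ∧ bag T y v)) (orthogonal x y)
  edgeBound : edgeCount G ≤ (k ∸ 1) * magnitude S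
  edgeBound = begin
    edgeCount G                                      ≤⟨ edgeCount≤∑bags G S ⟩
    ∑[ x < nodes S ] edgesIn G (bag S x)             ≤⟨ ∑-mono (λ x → edgesIn-thin T k (bag S x) (bags-thin x)) ⟩
    ∑[ x < nodes S ] ((k ∸ 1) * size (bag S x))      ≡⟨ sym (*-distribˡ-sum (k ∸ 1) (size ∘ bag S)) ⟩
    (k ∸ 1) * ∑[ x < nodes S ] size (bag S x)        ≡⟨ cong ((k ∸ 1) *_) magnitude≡ ⟨
    (k ∸ 1) * magnitude S                            ∎
    where
    open ≤-Reasoning
    magnitude≡ : magnitude S ≡ ∑[ x < nodes S ] size (bag S x)
    magnitude≡ = trans (sum-allFin (count ∘ bag S)) (sum-cong-≗ (count≡size ∘ bag S))
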